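{- Let $(S,\Sigma,\delta,\mathrm{rew},\alpha)$ be a deterministic automaton with rewards and $(S,\Sigma,\delta,\alpha)$ its underlying deterministic automaton. Let $\{\mathcal{G}_n\}_{n\in\mathbb{N}}$ be its graded similarity and $\mathcal{S}\subseteq S\times S$ the similarity of the underlying deterministic automaton. Then $\bigcup_{n\in\mathbb{N}}\mathcal{G}_n\subseteq\mathcal{S}$.
   Context: A DAwR consists of a set $S$, an alphabet $\Sigma$, $\delta\colon S\to S^\Sigma$, accepting states $\alpha\subseteq S$ and rewards $\mathrm{rew}\colon S\to\mathbb{N}^\Sigma$; write $\delta(s,a),\mathrm{rew}(s,a)$. A simulation on the DA $(S,\Sigma,\delta,\alpha)$ is $R\subseteq S\times S$ such that for $(s,s')\in R$: $s\in\alpha\Rightarrow s'\in\alpha$ and $(\delta(s,a),\delta(s',a))\in R$ for all $a$; the similarity is the largest simulation. A graded simulation on the DAwR is a family $\{\mathcal{A}_n\}_{n\in\mathbb{N}}$ of relations on $S$ such that whenever $(s,s')\in\mathcal{A}_n$: $s\in\alpha\Rightarrow s'\in\alpha$, and for every $a\in\Sigma$, $\mathrm{rew}(s,a)\le n+\mathrm{rew}(s',a)$ and $(\delta(s,a),\delta(s',a))\in\mathcal{A}_{n-\mathrm{rew}(s,a)+\mathrm{rew}(s',a)}$. The graded similarity is the largest graded simulation with respect to gradewise inclusion (i.e. the greatest fixed point of the corresponding monotone operator on $\mathbb{N}$-indexed families of relations on $S$). -}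

module Defs where

open import Level using (Level; _⊔_; suc)
open import Data.Nat using (ℕ; _+_; _∸_; _≤_)
open import Data.Product using (_×_; Σ)
open import Relation.Binary using (Rel)

record DAwR (S A : Set) : Set₁ where
  field
    δ   : S → A → S
    α   : S → Set
    rew : S → A → ℕ

module _ {S A : Set} (M : DAwR S A) where
  open DAwR M

  IsSimulation : Rel S Level.zero → Set
  IsSimulation R = ∀ {s s'} → R s s' →
    (α s → α s') × (∀ a → R (δ s a) (δ s' a))

  IsSimilarity : Rel S Level.zero → Set₁
  IsSimilarity 𝓢 = IsSimulation 𝓢 × (∀ R → IsSimulation R → ∀ {s s'} → R s s' → 𝓢 s s')

  -- The index n - rew(s,a) + rew(s',a) is computed as (n + rew s' a) ∸ rew s a,
  -- which is exact thanks to the accompanying condition rew s a ≤ n + rew s' a.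
  IsGradedSimulation : (ℕ → Rel S Level.zero) → Set
  IsGradedSimulation 𝓐 = ∀ {n s s'} → 𝓐 n s s' →
    (α s → α s') ×
    (∀ a → (rew s a ≤ n + rew s' a) ×
           𝓐 ((n + rew s' a) ∸ rew s a) (δ s a) (δ s' a))

  IsGradedSimilarity : (ℕ → Rel S Level.zero) → Set₁
  IsGradedSimilarity 𝓖 = IsGradedSimulation 𝓖 ×
    (∀ 𝓐 → IsGradedSimulation 𝓐 → ∀ {n s s'} → 𝓐 n s s' → 𝓖 n s s')

{-# OPTIONS --safe #-}
module Submission where

open import Defs
open import Data.Nat using (ℕ; _+_; _∸_)
open import Data.Product using (∃-syntax; _,_; proj₁; proj₂)
open import Relation.Binary using (Rel)
open import Level using (0ℓ)

⋃-grades : {S : Set} → (ℕ → Rel S 0ℓ) → Rel S 0ℓ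
⋃-grades 𝓐 s s' = ∃[ n ] 𝓐 n s s'

module _ {S A : Set} (M : DAwR S A) where
  open DAwR M

  ⋃-gradedSimulation⇒simulation : {𝓐 : ℕ → Rel S 0ℓ} →
    IsGradedSimulation M 𝓐 → IsSimulation M (⋃-grades 𝓐)
  ⋃-gradedSimulation⇒simulation sim {s} {s'} (n , sAs') =
    proj₁ (sim sAs') , λ a → (n + rew s' a) ∸ rew s a , proj₂ (proj₂ (sim sAs') a)

corollary1 : {S A : Set} (M : DAwR S A) (𝓖 : ℕ → Rel S 0ℓ) (𝓢 : Rel S 0ℓ) →
             IsGradedSimilarity M 𝓖 → IsSimilarity M 𝓢 →
             ∀ (n : ℕ) {s s' : S} → 𝓖 n s s' → 𝓢 s s'
corollary1 M 𝓖 𝓢 (𝓖-isGradedSimulation , _) (_ , 𝓢-largest) n sGs' =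
  𝓢-largest (⋃-grades 𝓖) (⋃-gradedSimulation⇒simulation M 𝓖-isGradedSimulation) (n , sGs')
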